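{- If $G$ is a $2$-connected chordal graph, then $h_\Delta(G)=\max\{2,\alpha(G)\}$.
   Context: All graphs are finite, simple, undirected and connected. A graph is chordal if every cycle on four or more vertices has a chord. $\alpha(G)$ is the independence number. For $S\subseteq V(G)$, the $\Delta$-interval $[S]$ is the set consisting of all vertices of $S$ together with every vertex $v$ adjacent to both $x$ and $y$ for some pair of adjacent vertices $x,y\in S$. A set $S$ is $\Delta$-convex if $[S]=S$, and $\langle S\rangle$ denotes the smallest $\Delta$-convex set containing $S$ ($\langle\emptyset\rangle=\emptyset$). A set $S$ is Helly dependent if $\bigcap_{a\in S}\langle S\setminus\{a\}\rangle\neq\emptyset$ and Helly independent otherwise. The Helly number $h_\Delta(G)$ is the least integer $n\ge0$ such that every $S\subseteq V(G)$ with $|S|>n$ is Helly dependent (equivalently, the maximum size of a Helly independent set). -}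

module Defs where

open import Data.Nat using (ℕ; zero; suc; _≤_; _<_; _∸_; _⊔_)
open import Data.Fin using (Fin; toℕ)
open import Data.Fin.Subset using (Subset; _∈_; _∉_; _⊆_; ∣_∣; _-_)
open import Data.Bool using (Bool; T)
open import Data.Product using (Σ; ∃; ∃-syntax; _×_; _,_)
open import Data.Sum using (_⊎_)
open import Relation.Nullary using (¬_)
open import Relation.Binary.PropositionalEquality using (_≡_; _≢_)
open import Function.Definitions using (Injective)

record Graph : Set where
  field
    n     : ℕ
    adj   : Fin n → Fin n → Bool
    sym   : ∀ u v → adj u v ≡ adj v u
    irrefl : ∀ v → adj v v ≡ Data.Bool.false

open Graph public

V : Graph → Set
V G = Fin (n G)

E : (G : Graph) → V G → V G → Set
E G u v = T (adj G u v)

data Reach (G : Graph) (P : V G → Set) : V G → V G → Set where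
  here : ∀ {v} → P v → Reach G P v v
  step : ∀ {u w v} → P u → E G u w → Reach G P w v → Reach G P u v

ConnectedOn : (G : Graph) → (V G → Set) → Set
ConnectedOn G P = ∀ u v → P u → P v → Reach G P u v

Connected : Graph → Set
Connected G = ConnectedOn G (λ _ → Data.Unit.⊤)
  where import Data.Unit

TwoConnected : Graph → Set
TwoConnected G =
  (3 ≤ n G) × Connected G × (∀ (x : V G) → ConnectedOn G (λ v → v ≢ x))

CycAdj : {k : ℕ} → Fin k → Fin k → Set
CycAdj {k} i j =
  (toℕ j ≡ suc (toℕ i)) ⊎ (toℕ i ≡ suc (toℕ j)) ⊎
  ((toℕ i ≡ 0) × (toℕ j ≡ k ∸ 1)) ⊎ ((toℕ j ≡ 0) × (toℕ i ≡ k ∸ 1))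

IsCycle : (G : Graph) (k : ℕ) → (Fin k → V G) → Set
IsCycle G k c = Injective _≡_ _≡_ c × (∀ i j → CycAdj i j → E G (c i) (c j))

HasChord : (G : Graph) (k : ℕ) → (Fin k → V G) → Set
HasChord G k c = ∃[ i ] ∃[ j ] (¬ CycAdj i j × E G (c i) (c j))

Chordal : Graph → Set
Chordal G = ∀ (k : ℕ) (c : Fin k → V G) → 4 ≤ k → IsCycle G k c → HasChord G k c

Independent : (G : Graph) → Subset (n G) → Set
Independent G S = ∀ u v → u ∈ S → v ∈ S → ¬ E G u v

IsIndependenceNumber : (G : Graph) → ℕ → Set
IsIndependenceNumber G a =
  (∃[ S ] (Independent G S × ∣ S ∣ ≡ a)) ×
  (∀ S → Independent G S → ∣ S ∣ ≤ a)

InInterval : (G : Graph) → Subset (n G) → V G → Set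
InInterval G S v =
  v ∈ S ⊎ (∃[ x ] ∃[ y ] (x ∈ S × y ∈ S × E G x y × E G v x × E G v y))

-- [S] = S  (S ⊆ [S] always holds, so this is [S] ⊆ S)
DeltaConvex : (G : Graph) → Subset (n G) → Set
DeltaConvex G S = ∀ v → InInterval G S v → v ∈ S

InHull : (G : Graph) → Subset (n G) → V G → Set
InHull G S v = ∀ T → DeltaConvex G T → S ⊆ T → v ∈ T

HellyDependent : (G : Graph) → Subset (n G) → Set
HellyDependent G S = ∃[ v ] (∀ a → a ∈ S → InHull G (S - a) v)

HellyIndependent : (G : Graph) → Subset (n G) → Set
HellyIndependent G S = ¬ HellyDependent G S

HellyBound : (G : Graph) → ℕ → Set
HellyBound G m = ∀ S → m < ∣ S ∣ → HellyDependent G S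

IsHellyNumber : (G : Graph) → ℕ → Set
IsHellyNumber G h = HellyBound G h × (∀ m → HellyBound G m → h ≤ m)

-- Upper bound: a set S of more than max(2, α) vertices is not independent, so it contains an edge xy,
-- and it contains a third vertex z. In a 2-connected chordal graph the Δ-hull of an edge is the whole
-- vertex set, so z ∈ ⟨S - a⟩ for every a ∈ S: for a = z because xy ⊆ S - z, otherwise because z ∈ S - a.
-- Lower bound: if every S - a is Δ-convex then ⋂ ⟨S - a⟩ = ⋂ (S - a) = ∅; this applies to independent
-- sets and to sets of two vertices.
--
-- The Δ-hull of an edge xy: let C be Δ-convex with x, y ∈ C and K the component of x in G[C]. Then K
-- contains every common neighbour of two adjacent vertices of K. If some vertex lies outside K, there is
-- an edge uw leaving K, and 2-connectedness gives a path from w back to K avoiding u; together with a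
-- path inside K this is a cycle through an edge of K that leaves K. A shortest such cycle is either a
-- triangle, impossible by the closure property, or has a chord (G is chordal) that cuts off a shorter one.
module Submission where

open import Defs hiding (sym)
open import Data.Bool using (true; false; T; T?)
open import Data.Empty using (⊥; ⊥-elim)
open import Data.Fin using (Fin; toℕ; fromℕ<)
import Data.Fin as Fin
open import Data.Fin.Properties using (toℕ-injective; toℕ<n; toℕ-fromℕ<; any?) renaming (_≟_ to _≟ᶠ_)
open import Data.Fin.Subset using (Subset; _∈_; _∉_; _─_; _-_; ∣_∣; ⁅_⁆; _∪_; Nonempty)
open import Data.Fin.Subset.Properties
  using ( _∈?_; p─q⊆p; p─⊥≡p; x∈⁅x⁆; x∈⁅y⁆⇒x≡y; x∈p∪q⁺; x∈p∪q⁻; x∈p∧x≢y⇒x∈p-y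
        ; ∣⁅x⁆∣≡1; ∣⊥∣≡0; p⊆q⇒∣p∣≤∣q∣; x∈p⇒∣p-x∣<∣p∣; nonempty?; Empty-unique)
open import Data.List using (List; []; _∷_; _++_)
open import Data.List.Membership.Propositional using (lose) renaming (_∈_ to _∈ᴸ_)
import Data.List.Membership.DecPropositional as DecMembership
open import Data.List.Relation.Binary.Disjoint.Propositional using (Disjoint)
open import Data.List.Relation.Binary.Sublist.Propositional using (_⊆_; []; _∷_; _∷ʳ_; ⊆-refl; from∈)
open import Data.List.Relation.Binary.Sublist.Propositional.Properties using (All-resp-⊆; ++⁺; ++⁺ˡ)
open import Data.List.Relation.Unary.All as All using (All; []; _∷_)
open import Data.List.Relation.Unary.All.Properties using (¬Any⇒All¬; Any¬⇒¬All)
open import Data.List.Relation.Unary.AllPairs using ([]; _∷_)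
open import Data.List.Relation.Unary.Any using (Any; here; there)
import Data.List.Relation.Unary.Any.Properties as Any
open import Data.List.Relation.Unary.Unique.Propositional using (Unique)
import Data.List.Relation.Unary.Unique.Propositional.Properties as Unique
open import Data.Nat using (ℕ; zero; suc; _+_; _≤_; _<_; z≤n; s≤s; _⊔_)
open import Data.Nat.Induction using (<-wellFounded)
open import Data.Nat.Properties
open import Data.Nat.Tactic.RingSolver using (solve-∀)
open import Data.Product using (∃; ∃₂; Σ-syntax; _×_; _,_; proj₁; proj₂)
open import Data.Sum using (_⊎_; inj₁; inj₂)
open import Data.Unit using (tt)
open import Data.Vec.Base using (_∷_; here; there)
open import Function using (id; _∘_; case_of_)
open import Induction.WellFounded using (Acc; acc)
open import Relation.Binary.Definitions using (tri<; tri≈; tri>)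
open import Relation.Binary.PropositionalEquality using (_≡_; _≢_; refl; cong; subst; subst₂)
import Relation.Binary.PropositionalEquality as ≡
open import Relation.Nullary using (¬_; ¬?; Dec; yes; no)
open import Relation.Nullary.Decidable using (_×-dec_; ¬¬-excluded-middle)

Unique-resp-⊆ : ∀ {A : Set} {xs ys : List A} → xs ⊆ ys → Unique ys → Unique xs
Unique-resp-⊆ []         _          = []
Unique-resp-⊆ (_ ∷ʳ τ)   (_ ∷ uys)  = Unique-resp-⊆ τ uys
Unique-resp-⊆ (refl ∷ τ) (y∉ ∷ uys) = All-resp-⊆ τ y∉ ∷ Unique-resp-⊆ τ uys

nonclosing-lengths : ∀ lb lm la → ¬ (lb ≡ 0 × suc lb + suc lm ≡ lb + suc (lm + suc la)) → 0 < lb + la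
nonclosing-lengths zero     lm zero     ¬closing = ⊥-elim (¬closing (refl , cong suc (+-comm 1 lm)))
nonclosing-lengths zero     lm (suc la) _        = s≤s z≤n
nonclosing-lengths (suc lb) lm la       _        = s≤s z≤n

shortcut-shorter : ∀ lb lm la → lb + suc la < lb + suc (lm + suc la)
shortcut-shorter lb lm la = +-monoʳ-< lb (s≤s (m≤n+m (suc la) lm))

arc-shorter : ∀ lb lm la → 0 < lb + la → suc (lm + 1) < lb + suc (lm + suc la)
arc-shorter lb lm la 0<lb+la = begin-strict
  suc (lm + 1)             ≡⟨ eq₁ lm ⟩
  lm + 2                   <⟨ +-monoʳ-< lm (s≤s (s≤s 0<lb+la)) ⟩
  lm + suc (suc (lb + la)) ≡⟨ eq₂ lb lm la ⟩
  lb + suc (lm + suc la)   ∎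
  where
  open ≤-Reasoning
  eq₁ : ∀ lm → suc (lm + 1) ≡ lm + 2
  eq₁ = solve-∀
  eq₂ : ∀ lb lm la → lm + suc (suc (lb + la)) ≡ lb + suc (lm + suc la)
  eq₂ = solve-∀

module _ (G : Graph) where

  E-sym : ∀ {u v} → E G u v → E G v u
  E-sym {u} {v} = subst T (Graph.sym G u v)

  E-irrefl : ∀ {v} → ¬ E G v v
  E-irrefl {v} = subst T (Graph.irrefl G v)

  module _ {P : V G → Set} where

    reach-source : ∀ {a c} → Reach G P a c → P a
    reach-source (here pa)     = pa
    reach-source (step pa _ _) = pa

    reach-target : ∀ {a c} → Reach G P a c → P c
    reach-target (here pc)    = pc
    reach-target (step _ _ r) = reach-target r

    reach-snoc : ∀ {a b c} → Reach G P a b → E G b c → P c → Reach G P a c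
    reach-snoc (here pa)     bc pc = step pa bc (here pc)
    reach-snoc (step pa e r) bc pc = step pa e (reach-snoc r bc pc)

    reach-++ : ∀ {a b c} → Reach G P a b → Reach G P b c → Reach G P a c
    reach-++ (here _)      r′ = r′
    reach-++ (step pa e r) r′ = step pa e (reach-++ r r′)

    reach-reverse : ∀ {a c} → Reach G P a c → Reach G P c a
    reach-reverse (here pa)     = here pa
    reach-reverse (step pa e r) = reach-snoc (reach-reverse r) (E-sym e) pa

    reach-component : ∀ {x a c} → Reach G P x a → Reach G P a c → Reach G (Reach G P x) a c
    reach-component xa (here _)     = here xa
    reach-component xa (step _ e r) = step xa e (reach-component (reach-snoc xa e (reach-source r)) r)

    -- Q need not be decidable; the double negation pays for deciding Q along the walk.
    first-entry : ∀ {Q : V G → Set} {a c} → Reach G P a c → ¬ Q a → Q c →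
                  ¬ ¬ (∃₂ λ q b → Reach G (λ v → ¬ Q v) a q × E G q b × Q b × P b)
    first-entry (here _) ¬Qa Qc _ = ¬Qa Qc
    first-entry {Q} (step {w = w} _ e r) ¬Qa Qc found = ¬¬-excluded-middle {A = Q w} λ where
      (yes Qw) → found (_ , _ , here ¬Qa , e , Qw , reach-source r)
      (no ¬Qw) → first-entry r ¬Qw Qc λ (q , b , wq , rest) → found (q , b , step ¬Qa e wq , rest)

  infixr 5 _∷⟨_⟩_ _++⟨_⟩_

  data Walk : V G → V G → Set where
    [_]    : ∀ v → Walk v v
    _∷⟨_⟩_ : ∀ u {w v} → E G u w → Walk w v → Walk u v

  vertices : ∀ {a c} → Walk a c → List (V G)
  vertices [ v ]        = v ∷ []
  vertices (u ∷⟨ _ ⟩ p) = u ∷ vertices p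

  len : ∀ {a c} → Walk a c → ℕ
  len [ _ ]        = 0
  len (_ ∷⟨ _ ⟩ p) = suc (len p)

  -- Positions past the end all denote the last vertex.
  at : ∀ {a c} → Walk a c → ℕ → V G
  at [ v ]        _       = v
  at (u ∷⟨ _ ⟩ p) zero    = u
  at (u ∷⟨ _ ⟩ p) (suc t) = at p t

  _++⟨_⟩_ : ∀ {a b b′ c} → Walk a b → E G b b′ → Walk b′ c → Walk a c
  [ v ]         ++⟨ e ⟩ q = v ∷⟨ e ⟩ q
  (u ∷⟨ e′ ⟩ p) ++⟨ e ⟩ q = u ∷⟨ e′ ⟩ (p ++⟨ e ⟩ q)

  vertices-++ : ∀ {a b b′ c} (p : Walk a b) (e : E G b b′) (q : Walk b′ c) →
                vertices (p ++⟨ e ⟩ q) ≡ vertices p ++ vertices q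
  vertices-++ [ _ ]        e q = refl
  vertices-++ (u ∷⟨ _ ⟩ p) e q = cong (u ∷_) (vertices-++ p e q)

  len-++ : ∀ {a b b′ c} (p : Walk a b) (e : E G b b′) (q : Walk b′ c) →
           len (p ++⟨ e ⟩ q) ≡ len p + suc (len q)
  len-++ [ _ ]        e q = refl
  len-++ (_ ∷⟨ _ ⟩ p) e q = cong suc (len-++ p e q)

  len-++-++ : ∀ {a b b′ c c′ d} (p : Walk a b) (e : E G b b′) (q : Walk b′ c) (e′ : E G c c′) (r : Walk c′ d) →
              len (p ++⟨ e ⟩ q ++⟨ e′ ⟩ r) ≡ len p + suc (len q + suc (len r))
  len-++-++ p e q e′ r = ≡.trans (len-++ p e _) (cong (λ l → len p + suc l) (len-++ q e′ r))

  at-source : ∀ {a c} (p : Walk a c) → at p 0 ≡ a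
  at-source [ _ ]        = refl
  at-source (_ ∷⟨ _ ⟩ _) = refl

  at-target : ∀ {a c} (p : Walk a c) → at p (len p) ≡ c
  at-target [ _ ]        = refl
  at-target (_ ∷⟨ _ ⟩ p) = at-target p

  at-step : ∀ {a c} (p : Walk a c) t → t < len p → E G (at p t) (at p (suc t))
  at-step (u ∷⟨ e ⟩ p) zero    _        = subst (E G u) (≡.sym (at-source p)) e
  at-step (_ ∷⟨ _ ⟩ p) (suc t) (s≤s t<) = at-step p t t<

  at-++-target : ∀ {a b b′ c} (p : Walk a b) (e : E G b b′) (q : Walk b′ c) → at (p ++⟨ e ⟩ q) (len p) ≡ b
  at-++-target [ _ ]        e q = refl
  at-++-target (_ ∷⟨ _ ⟩ p) e q = at-++-target p e q

  at-++-source : ∀ {a b b′ c} (p : Walk a b) (e : E G b b′) (q : Walk b′ c) → at (p ++⟨ e ⟩ q) (suc (len p)) ≡ b′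
  at-++-source [ _ ]        e q = at-source q
  at-++-source (_ ∷⟨ _ ⟩ p) e q = at-++-source p e q

  at-++ʳ : ∀ {a b b′ c} (p : Walk a b) (e : E G b b′) (q : Walk b′ c) t →
           at (p ++⟨ e ⟩ q) (suc (len p) + t) ≡ at q t
  at-++ʳ [ _ ]        e q t = refl
  at-++ʳ (_ ∷⟨ _ ⟩ p) e q t = at-++ʳ p e q t

  at-∈ : ∀ {a c} (p : Walk a c) t → t ≤ len p → at p t ∈ᴸ vertices p
  at-∈ [ _ ]        zero    _        = here refl
  at-∈ (_ ∷⟨ _ ⟩ _) zero    _        = here refl
  at-∈ (_ ∷⟨ _ ⟩ p) (suc t) (s≤s t≤) = there (at-∈ p t t≤)

  source-∈ : ∀ {a c} (p : Walk a c) → a ∈ᴸ vertices p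
  source-∈ [ _ ]        = here refl
  source-∈ (_ ∷⟨ _ ⟩ _) = here refl

  target-∈ : ∀ {a c} (p : Walk a c) → c ∈ᴸ vertices p
  target-∈ p = subst (_∈ᴸ vertices p) (at-target p) (at-∈ p (len p) ≤-refl)

  at-injective : ∀ {a c} (p : Walk a c) → Unique (vertices p) →
                 ∀ {s t} → s ≤ len p → t ≤ len p → at p s ≡ at p t → s ≡ t
  at-injective [ _ ]        _         {zero}  {zero}  _        _        _  = refl
  at-injective (_ ∷⟨ _ ⟩ _) _         {zero}  {zero}  _        _        _  = refl
  at-injective (_ ∷⟨ _ ⟩ p) (u∉ ∷ _)  {zero}  {suc t} _        (s≤s t≤) eq = ⊥-elim (All.lookup u∉ (at-∈ p t t≤) eq)
  at-injective (_ ∷⟨ _ ⟩ p) (u∉ ∷ _)  {suc s} {zero}  (s≤s s≤) _        eq = ⊥-elim (All.lookup u∉ (at-∈ p s s≤) (≡.sym eq))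
  at-injective (_ ∷⟨ _ ⟩ p) (_ ∷ up) {suc s} {suc t} (s≤s s≤) (s≤s t≤) eq = cong suc (at-injective p up s≤ t≤ eq)

  record Path (P : V G → Set) (a c : V G) : Set where
    field
      walk   : Walk a c
      inside : All P (vertices walk)
      simple : Unique (vertices walk)

  suffix-from : ∀ {P a b c} (p : Walk b c) → a ∈ᴸ vertices p →
                All P (vertices p) → Unique (vertices p) → Path P a c
  suffix-from [ v ]        (here refl) Pp up = record { walk = [ v ] ; inside = Pp ; simple = up }
  suffix-from (u ∷⟨ e ⟩ p) (here refl) Pp up = record { walk = u ∷⟨ e ⟩ p ; inside = Pp ; simple = up }
  suffix-from (_ ∷⟨ _ ⟩ p) (there a∈) (_ ∷ Pp) (_ ∷ up) = suffix-from p a∈ Pp up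

  open DecMembership (_≟ᶠ_ {n G}) using () renaming (_∈?_ to _∈ᴸ?_)

  reach⇒path : ∀ {P a c} → Reach G P a c → Path P a c
  reach⇒path (here {v} pv) = record { walk = [ v ] ; inside = pv ∷ [] ; simple = [] ∷ [] }
  reach⇒path {a = a} (step pa e r) with reach⇒path r
  ... | record { walk = q ; inside = Pq ; simple = uq } with a ∈ᴸ? vertices q
  ...   | yes a∈ = suffix-from q a∈ Pq uq
  ...   | no  a∉ = record { walk = a ∷⟨ e ⟩ q ; inside = pa ∷ Pq ; simple = ¬Any⇒All¬ _ a∉ ∷ uq }

  -- Chords of cycles
  walk-cycle : ∀ {a c} (p : Walk a c) → Unique (vertices p) → E G c a → IsCycle G (suc (len p)) (at p ∘ toℕ)
  walk-cycle p simple closing = (λ eq → toℕ-injective (at-injective p simple (bound _) (bound _) eq)) , adjacent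
    where
    bound : (i : Fin (suc (len p))) → toℕ i ≤ len p
    bound i = ≤-pred (toℕ<n i)

    consecutive : ∀ i j → toℕ j ≡ suc (toℕ i) → E G (at p (toℕ i)) (at p (toℕ j))
    consecutive i j j≡ = subst (λ t → E G (at p (toℕ i)) (at p t)) (≡.sym j≡)
                           (at-step p (toℕ i) (subst (_≤ len p) j≡ (bound j)))

    ends : ∀ i j → toℕ i ≡ 0 → toℕ j ≡ len p → E G (at p (toℕ i)) (at p (toℕ j))
    ends i j i≡ j≡ = subst₂ (λ s t → E G (at p s) (at p t)) (≡.sym i≡) (≡.sym j≡)
                       (subst₂ (E G) (≡.sym (at-source p)) (≡.sym (at-target p)) (E-sym closing))

    adjacent : ∀ i j → CycAdj i j → E G (at p (toℕ i)) (at p (toℕ j))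
    adjacent i j (inj₁ j≡)                      = consecutive i j j≡
    adjacent i j (inj₂ (inj₁ i≡))               = E-sym (consecutive j i i≡)
    adjacent i j (inj₂ (inj₂ (inj₁ (i≡ , j≡)))) = ends i j i≡ j≡
    adjacent i j (inj₂ (inj₂ (inj₂ (j≡ , i≡)))) = E-sym (ends j i j≡ i≡)

  record SplitAt {a c} (p : Walk a c) (s : ℕ) : Set where
    field
      {u u′}    : V G
      front     : Walk a u
      link      : E G u u′
      back      : Walk u′ c
      joins     : p ≡ front ++⟨ link ⟩ back
      len-front : len front ≡ s

  split-at : ∀ {a c} (p : Walk a c) s → s < len p → SplitAt p s
  split-at (x ∷⟨ e ⟩ p) zero    _        = record { front = [ x ] ; link = e ; back = p ; joins = refl ; len-front = refl }
  split-at (x ∷⟨ e ⟩ p) (suc s) (s≤s s<) = record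
    { front = x ∷⟨ e ⟩ front ; link = link ; back = back
    ; joins = cong (x ∷⟨ e ⟩_) joins ; len-front = cong suc len-front }
    where open SplitAt (split-at p s s<)

  -- p is read as a cycle closed by an edge from its target back to its source; the chord u–v
  -- differs from that closing edge because before and after are not both a single vertex.
  record Chorded {a c} (p : Walk a c) : Set where
    field
      {u u′ v′ v} : V G
      before      : Walk a u
      enter       : E G u u′
      between     : Walk u′ v′
      leave       : E G v′ v
      after       : Walk v c
      joins       : p ≡ before ++⟨ enter ⟩ between ++⟨ leave ⟩ after
      chord       : E G u v
      nonclosing  : 0 < len before + len after

  chorded-at : ∀ {a c} (p : Walk a c) s d → suc s + suc d ≤ len p →
               ¬ (s ≡ 0 × suc s + suc d ≡ len p) → E G (at p s) (at p (suc s + suc d)) → Chorded p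
  chorded-at p s d t≤ ¬closing chord with split-at p s (≤-trans (s≤s (m≤m+n s (suc d))) t≤)
  ... | record { front = before ; link = enter ; back = back ; joins = refl ; len-front = refl }
    with split-at back d (≤-pred (+-cancelˡ-≤ (len before) _ _
           (subst₂ _≤_ (≡.sym (+-suc (len before) (suc d))) (len-++ before enter back) t≤)))
  ... | record { front = between ; link = leave ; back = after ; joins = refl ; len-front = refl } = record
    { before = before ; enter = enter ; between = between ; leave = leave ; after = after ; joins = refl
    ; chord = subst₂ (E G) (at-++-target before enter _)
                (≡.trans (at-++ʳ before enter _ (suc (len between))) (at-++-source between leave after)) chord
    ; nonclosing = nonclosing-lengths (len before) (len between) (len after)
        (λ (b≡0 , closes) → ¬closing (b≡0 , ≡.trans closes (≡.sym (len-++-++ before enter between leave after)))) }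

  chorded-between : ∀ {a c} (p : Walk a c) s t → s < t → t ≤ len p → t ≢ suc s →
                    ¬ (s ≡ 0 × t ≡ len p) → E G (at p s) (at p t) → Chorded p
  chorded-between p s t s<t t≤ t≢ ¬closing chord with m≤n⇒∃[o]m+o≡n s<t
  ... | zero  , refl = ⊥-elim (t≢ (+-identityʳ (suc s)))
  ... | suc d , refl = chorded-at p s d t≤ ¬closing chord

  chord-decomposition : Chordal G → ∀ {a c} (p : Walk a c) → 3 ≤ len p → Unique (vertices p) → E G c a → Chorded p
  chord-decomposition chordal p 3≤ simple closing
    with chordal (suc (len p)) (at p ∘ toℕ) (s≤s 3≤) (walk-cycle p simple closing)
  ... | i , j , ¬adjacent , chord with <-cmp (toℕ i) (toℕ j)
  ... | tri< i<j _ _ = chorded-between p (toℕ i) (toℕ j) i<j (≤-pred (toℕ<n j))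
                         (¬adjacent ∘ inj₁) (¬adjacent ∘ inj₂ ∘ inj₂ ∘ inj₁) chord
  ... | tri≈ _ i≡j _ = ⊥-elim (E-irrefl (subst (λ t → E G (at p (toℕ i)) (at p t)) (≡.sym i≡j) chord))
  ... | tri> _ _ j<i = chorded-between p (toℕ j) (toℕ i) j<i (≤-pred (toℕ<n i))
                         (¬adjacent ∘ inj₂ ∘ inj₁) (¬adjacent ∘ inj₂ ∘ inj₂ ∘ inj₂) (E-sym chord)

  -- Cycles leaving a Δ-closed set
  module _ (K : V G → Set) where

    Δ-Closed : Set
    Δ-Closed = ∀ {o a b} → E G o a → E G o b → E G a b → K a → K b → K o

    record EscapingCycle : Set where
      field
        {source target} : V G
        walk            : Walk source target
        simple          : Unique (vertices walk)
        closing         : E G target source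
        source∈K        : K source
        target∈K        : K target
        escapes         : Any (λ v → ¬ K v) (vertices walk)

    size : EscapingCycle → ℕ
    size C = len (EscapingCycle.walk C)

    -- The chord splits the cycle into a shortcut, which keeps the closing edge, and an arc closed
    -- by the chord; whichever contains the escaping vertex is again an escaping cycle.
    shrink-along-chord : (C : EscapingCycle) → Chorded (EscapingCycle.walk C) →
                         ¬ ¬ (Σ[ C′ ∈ EscapingCycle ] size C′ < size C)
    shrink-along-chord
      record { simple = simple ; closing = closing ; source∈K = a∈K ; target∈K = c∈K ; escapes = escapes }
      record { u = u ; v = v ; before = before ; enter = enter ; between = between ; leave = leave ; after = after
             ; joins = refl ; chord = chord ; nonclosing = nonclosing } shrunk =
      ¬¬-excluded-middle {A = K u} λ where
        (no ¬Ku) → shrunk (shortcut (Any.++⁺ˡ (lose (target-∈ before) ¬Ku)))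
        (yes Ku) → ¬¬-excluded-middle {A = K v} λ where
          (no ¬Kv) → shrunk (shortcut (Any.++⁺ʳ (vertices before) (lose (source-∈ after) ¬Kv)))
          (yes Kv) → case Any.++⁻ (vertices before) (subst (Any _) vs escapes) of λ where
            (inj₁ in-before) → shrunk (shortcut (Any.++⁺ˡ in-before))
            (inj₂ rest) → case Any.++⁻ (vertices between) rest of λ where
              (inj₁ in-between) → shrunk (arc Ku Kv in-between)
              (inj₂ in-after)   → shrunk (shortcut (Any.++⁺ʳ (vertices before) in-after))
      where
      whole = before ++⟨ enter ⟩ between ++⟨ leave ⟩ after

      vs : vertices whole ≡ vertices before ++ vertices between ++ vertices after
      vs = ≡.trans (vertices-++ before enter _) (cong (vertices before ++_) (vertices-++ between leave after))

      unique-⊆ : ∀ {xs} → xs ⊆ vertices before ++ vertices between ++ vertices after → Unique xs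
      unique-⊆ τ = Unique-resp-⊆ τ (subst Unique vs simple)

      shortcut : Any (λ v → ¬ K v) (vertices before ++ vertices after) → Σ[ C′ ∈ EscapingCycle ] size C′ < len whole
      shortcut esc =
        record { walk = before ++⟨ chord ⟩ after
               ; simple = subst Unique (≡.sym (vertices-++ before chord after))
                                (unique-⊆ (++⁺ (⊆-refl {x = vertices before}) (++⁺ˡ (vertices between) ⊆-refl)))
               ; closing = closing ; source∈K = a∈K ; target∈K = c∈K
               ; escapes = subst (Any _) (≡.sym (vertices-++ before chord after)) esc }
        , subst₂ _<_ (≡.sym (len-++ before chord after)) (≡.sym (len-++-++ before enter between leave after))
                 (shortcut-shorter (len before) (len between) (len after))

      arc : K u → K v → Any (λ v → ¬ K v) (vertices between) → Σ[ C′ ∈ EscapingCycle ] size C′ < len whole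
      arc Ku Kv esc =
        record { walk = u ∷⟨ enter ⟩ between ++⟨ leave ⟩ [ v ]
               ; simple = subst Unique (cong (u ∷_) (≡.sym (vertices-++ between leave [ v ])))
                                (unique-⊆ (++⁺ (from∈ (target-∈ before)) (++⁺ ⊆-refl (from∈ (source-∈ after)))))
               ; closing = E-sym chord ; source∈K = Ku ; target∈K = Kv
               ; escapes = there (subst (Any _) (≡.sym (vertices-++ between leave [ v ])) (Any.++⁺ˡ esc)) }
        , subst₂ _<_ (cong suc (≡.sym (len-++ between leave [ v ]))) (≡.sym (len-++-++ before enter between leave after))
                 (arc-shorter (len before) (len between) (len after) nonclosing)

    detour-cycle : ∀ {u b q w} → Path K u b → Path (λ v → ¬ K v) q w → u ≢ b → E G b q → E G w u → EscapingCycle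
    detour-cycle record { walk = [ _ ] } _ u≢b _ _ = ⊥-elim (u≢b refl)
    detour-cycle {u} record { walk = _ ∷⟨ uk ⟩ inner ; inside = u∈K ∷ inner⊆K ; simple = u∉inner ∷ inner-simple }
                 record { walk = out ; inside = out⊆∁K ; simple = out-simple } _ bq wu = record
      { walk     = inner ++⟨ bq ⟩ out ++⟨ wu ⟩ [ u ]
      ; simple   = subst Unique (≡.sym vs)
                     (Unique.++⁺ inner-simple (Unique.++⁺ out-simple ([] ∷ []) out∌u) inner-disjoint)
      ; closing  = uk
      ; source∈K = All.lookup inner⊆K (source-∈ inner)
      ; target∈K = u∈K
      ; escapes  = subst (Any _) (≡.sym vs)
                     (Any.++⁺ʳ (vertices inner) (Any.++⁺ˡ (lose (source-∈ out) (All.lookup out⊆∁K (source-∈ out))))) }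
      where
      vs : vertices (inner ++⟨ bq ⟩ out ++⟨ wu ⟩ [ u ]) ≡ vertices inner ++ vertices out ++ u ∷ []
      vs = ≡.trans (vertices-++ inner bq _) (cong (vertices inner ++_) (vertices-++ out wu [ u ]))

      out∌u : Disjoint (vertices out) (u ∷ [])
      out∌u (v∈out , here refl) = All.lookup out⊆∁K v∈out u∈K

      inner-disjoint : Disjoint (vertices inner) (vertices out ++ u ∷ [])
      inner-disjoint (v∈inner , v∈rest) with Any.++⁻ (vertices out) v∈rest
      ... | inj₁ v∈out       = All.lookup out⊆∁K v∈out (All.lookup inner⊆K v∈inner)
      ... | inj₂ (here refl) = All.lookup u∉inner v∈inner refl

  module _ (chordal : Chordal G) {K : V G → Set} (closed : Δ-Closed K) where

    escaping-cycle-shrinks : (C : EscapingCycle K) → ¬ ¬ (Σ[ C′ ∈ EscapingCycle K ] size K C′ < size K C)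
    escaping-cycle-shrinks record { walk = [ _ ] ; closing = aa } _ = E-irrefl aa
    escaping-cycle-shrinks record { walk = _ ∷⟨ _ ⟩ [ _ ] ; source∈K = a∈K ; target∈K = c∈K ; escapes = esc } _ =
      Any¬⇒¬All esc (a∈K ∷ c∈K ∷ [])
    escaping-cycle-shrinks
      record { walk = _ ∷⟨ ab ⟩ _ ∷⟨ bc ⟩ [ _ ] ; closing = ca ; source∈K = a∈K ; target∈K = c∈K ; escapes = esc } _ =
      Any¬⇒¬All esc (a∈K ∷ closed (E-sym ab) bc (E-sym ca) a∈K c∈K ∷ c∈K ∷ [])
    escaping-cycle-shrinks C@record { walk = p@(_ ∷⟨ _ ⟩ _ ∷⟨ _ ⟩ _ ∷⟨ _ ⟩ _) ; simple = simple ; closing = closing } =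
      shrink-along-chord K C (chord-decomposition chordal p (s≤s (s≤s (s≤s z≤n))) simple closing)

    no-escaping-cycle : ¬ EscapingCycle K
    no-escaping-cycle C = go C (<-wellFounded (size K C))
      where
      go : (C : EscapingCycle K) → Acc _<_ (size K C) → ⊥
      go C (acc smaller) = escaping-cycle-shrinks C λ (C′ , C′<C) → go C′ (smaller C′<C)

  -- The Δ-hull of an edge
  module _ (two-connected : TwoConnected G) (chordal : Chordal G) {C : Subset (n G)} (convex : DeltaConvex G C)
           {x y : V G} (x∈C : x ∈ C) (y∈C : y ∈ C) (xy : E G x y) where

    private
      Component : V G → Set
      Component = Reach G (_∈ C) x

      component-closed : Δ-Closed Component
      component-closed oa ob ab ka kb =
        reach-snoc ka (E-sym oa) (convex _ (inj₂ (_ , _ , reach-target ka , reach-target kb , ab , oa , ob)))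

      other-end : ∀ u → ∃ λ v → Component v × v ≢ u
      other-end u with x ≟ᶠ u
      ... | no  x≢u  = x , here x∈C , x≢u
      ... | yes refl = y , step x∈C xy (here y∈C) , λ { refl → E-irrefl xy }

      no-boundary-edge : ∀ {u w} → Component u → ¬ Component w → ¬ E G u w
      no-boundary-edge {u} {w} u∈K w∉K uw with other-end u
      ... | v , v∈K , v≢u =
        first-entry (proj₂ (proj₂ two-connected) u w v (λ { refl → w∉K u∈K }) v≢u) w∉K v∈K
          λ (q , b , wq , qb , b∈K , b≢u) → no-escaping-cycle chordal component-closed
            (detour-cycle Component
              (reach⇒path (reach-component u∈K (reach-++ (reach-reverse u∈K) b∈K)))
              (reach⇒path (reach-reverse wq)) (b≢u ∘ ≡.sym) (E-sym qb) (E-sym uw))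

    Δ-convex-full : ∀ z → z ∈ C
    Δ-convex-full z with z ∈? C
    ... | yes z∈C = z∈C
    ... | no  z∉C = ⊥-elim (first-entry (proj₁ (proj₂ two-connected) z x tt tt) (z∉C ∘ reach-target) (here x∈C)
                      λ (q , b , zq , qb , b∈K , _) → no-boundary-edge b∈K (reach-target zq) (E-sym qb))

-- Helly independence
x∈p─q⇒x∉q : ∀ {k} (p q : Subset k) {x} → x ∈ p ─ q → x ∉ q
x∈p─q⇒x∉q (_ ∷ p)     (_ ∷ q)    (there x∈) (there x∈q) = x∈p─q⇒x∉q p q x∈ x∈q
x∈p─q⇒x∉q (true ∷ p)  (true ∷ q) ()         here
x∈p─q⇒x∉q (false ∷ p) (true ∷ q) ()         here

x∈p-y⇒x≢y : ∀ {k} {p : Subset k} {x y} → x ∈ p - y → x ≢ y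
x∈p-y⇒x≢y {p = p} {y = y} x∈ refl = x∈p─q⇒x∉q p ⁅ y ⁆ x∈ (x∈⁅x⁆ y)

x∈p⇒1≤∣p∣ : ∀ {k} {p : Subset k} {x} → x ∈ p → 1 ≤ ∣ p ∣
x∈p⇒1≤∣p∣ {p = p} {x} x∈p = ≤-trans (≤-reflexive (≡.sym (∣⁅x⁆∣≡1 x)))
  (p⊆q⇒∣p∣≤∣q∣ λ v∈ → subst (_∈ p) (≡.sym (x∈⁅y⁆⇒x≡y x v∈)) x∈p)

∣p∣≤1+∣p-x∣ : ∀ {k} (p : Subset k) x → ∣ p ∣ ≤ suc ∣ p - x ∣
∣p∣≤1+∣p-x∣ (true ∷ p)  Fin.zero    = ≤-reflexive (cong (suc ∘ ∣_∣) (≡.sym (p─⊥≡p p)))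
∣p∣≤1+∣p-x∣ (false ∷ p) Fin.zero    = ≤-trans (n≤1+n _) (≤-reflexive (cong (suc ∘ ∣_∣) (≡.sym (p─⊥≡p p))))
∣p∣≤1+∣p-x∣ (true ∷ p)  (Fin.suc x) = s≤s (∣p∣≤1+∣p-x∣ p x)
∣p∣≤1+∣p-x∣ (false ∷ p) (Fin.suc x) = ∣p∣≤1+∣p-x∣ p x

third-element : ∀ {k} {S : Subset k} → 2 < ∣ S ∣ → ∀ x y → ∃ λ z → z ∈ S × z ≢ x × z ≢ y
third-element {k} {S} 2<∣S∣ x y with any? (λ z → z ∈? S ×-dec ¬? (z ≟ᶠ x) ×-dec ¬? (z ≟ᶠ y))
... | yes found = found
... | no  none  = ⊥-elim (<⇒≱ 2<∣S∣ (begin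
  ∣ S ∣                   ≤⟨ ∣p∣≤1+∣p-x∣ S x ⟩
  suc ∣ S - x ∣           ≤⟨ s≤s (∣p∣≤1+∣p-x∣ (S - x) y) ⟩
  suc (suc ∣ S - x - y ∣) ≡⟨ cong (suc ∘ suc) (≡.trans (cong ∣_∣ (Empty-unique nothing-left)) (∣⊥∣≡0 k)) ⟩
  2                       ∎))
  where
  open ≤-Reasoning
  nothing-left : ¬ Nonempty (S - x - y)
  nothing-left (z , z∈) = none (z , p─q⊆p S _ (p─q⊆p (S - x) _ z∈) , x∈p-y⇒x≢y (p─q⊆p (S - x) _ z∈) , x∈p-y⇒x≢y z∈)

∈-pair⁺ˡ : ∀ {k} {x y : Fin k} → x ∈ ⁅ x ⁆ ∪ ⁅ y ⁆
∈-pair⁺ˡ {x = x} = x∈p∪q⁺ (inj₁ (x∈⁅x⁆ x))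

∈-pair⁺ʳ : ∀ {k} {x y : Fin k} → y ∈ ⁅ x ⁆ ∪ ⁅ y ⁆
∈-pair⁺ʳ {y = y} = x∈p∪q⁺ (inj₂ (x∈⁅x⁆ y))

∈-pair⁻ : ∀ {k} {x y v : Fin k} → v ∈ ⁅ x ⁆ ∪ ⁅ y ⁆ → v ≡ x ⊎ v ≡ y
∈-pair⁻ {x = x} {y} v∈ with x∈p∪q⁻ ⁅ x ⁆ ⁅ y ⁆ v∈
... | inj₁ v∈x = inj₁ (x∈⁅y⁆⇒x≡y x v∈x)
... | inj₂ v∈y = inj₂ (x∈⁅y⁆⇒x≡y y v∈y)

2≤∣pair∣ : ∀ {k} {x y : Fin k} → x ≢ y → 2 ≤ ∣ ⁅ x ⁆ ∪ ⁅ y ⁆ ∣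
2≤∣pair∣ {x = x} {y} x≢y = ≤-trans (s≤s (x∈p⇒1≤∣p∣ (x∈p∧x≢y⇒x∈p-y (∈-pair⁺ʳ {x = x}) (x≢y ∘ ≡.sym))))
                                  (x∈p⇒∣p-x∣<∣p∣ (∈-pair⁺ˡ {x = x} {y}))

pair-minus-subsingleton : ∀ {k} {x y a u w : Fin k} → a ∈ ⁅ x ⁆ ∪ ⁅ y ⁆ →
                          u ∈ (⁅ x ⁆ ∪ ⁅ y ⁆) - a → w ∈ (⁅ x ⁆ ∪ ⁅ y ⁆) - a → u ≡ w
pair-minus-subsingleton a∈ u∈ w∈
  with ∈-pair⁻ a∈ | ∈-pair⁻ (p─q⊆p _ _ u∈) | ∈-pair⁻ (p─q⊆p _ _ w∈)
... | _         | inj₁ refl | inj₁ refl = refl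
... | _         | inj₂ refl | inj₂ refl = refl
... | inj₁ refl | inj₁ refl | inj₂ _    = ⊥-elim (x∈p-y⇒x≢y u∈ refl)
... | inj₁ refl | inj₂ _    | inj₁ refl = ⊥-elim (x∈p-y⇒x≢y w∈ refl)
... | inj₂ refl | inj₁ _    | inj₂ refl = ⊥-elim (x∈p-y⇒x≢y w∈ refl)
... | inj₂ refl | inj₂ refl | inj₁ _    = ⊥-elim (x∈p-y⇒x≢y u∈ refl)

module _ (G : Graph) where

  independent⇒Δ-convex : ∀ {S} → Independent G S → DeltaConvex G S
  independent⇒Δ-convex _   _ (inj₁ v∈S)                          = v∈S
  independent⇒Δ-convex ind _ (inj₂ (u , w , u∈S , w∈S , uw , _)) = ⊥-elim (ind u w u∈S w∈S uw)

  subsingleton⇒independent : ∀ {S} → (∀ {u w} → u ∈ S → w ∈ S → u ≡ w) → Independent G S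
  subsingleton⇒independent same u w u∈S w∈S uw = E-irrefl G (subst (E G u) (≡.sym (same u∈S w∈S)) uw)

  hull-⊇ : ∀ {S v} → v ∈ S → InHull G S v
  hull-⊇ v∈S _ _ S⊆T = S⊆T v∈S

  hull-⊆ : ∀ {S v} → DeltaConvex G S → InHull G S v → v ∈ S
  hull-⊆ {S} convex v∈⟨S⟩ = v∈⟨S⟩ S convex id

  -- A common point v of all ⟨S - a⟩ = S - a would lie in S - v.
  helly-independent : ∀ {S} → Nonempty S → (∀ {a} → a ∈ S → DeltaConvex G (S - a)) → HellyIndependent G S
  helly-independent {S} (a , a∈S) convex (v , v∈hulls) = x∈p-y⇒x≢y (hull-⊆ (convex v∈S) (v∈hulls v v∈S)) refl
    where
    v∈S : v ∈ S
    v∈S = p─q⊆p S ⁅ a ⁆ (hull-⊆ (convex a∈S) (v∈hulls a a∈S))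

  helly-independent⇒size≤ : ∀ {m S} → HellyBound G m → HellyIndependent G S → ∣ S ∣ ≤ m
  helly-independent⇒size≤ bound independent = ≮⇒≥ (independent ∘ bound _)

  independent⇒size≤ : ∀ {m S} → HellyBound G m → Independent G S → ∣ S ∣ ≤ m
  independent⇒size≤ {m} {S} bound independent with nonempty? S
  ... | yes nonempty = helly-independent⇒size≤ bound (helly-independent nonempty λ {a} _ →
        independent⇒Δ-convex λ u w u∈ w∈ → independent u w (p─q⊆p S ⁅ a ⁆ u∈) (p─q⊆p S ⁅ a ⁆ w∈))
  ... | no  empty    = subst (_≤ m) (≡.sym (≡.trans (cong ∣_∣ (Empty-unique empty)) (∣⊥∣≡0 (n G)))) z≤n

  pair-helly-independent : ∀ {x y} → HellyIndependent G (⁅ x ⁆ ∪ ⁅ y ⁆)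
  pair-helly-independent {x} = helly-independent (x , ∈-pair⁺ˡ) λ a∈ →
    independent⇒Δ-convex (subsingleton⇒independent (pair-minus-subsingleton a∈))

  2≤helly-bound : ∀ {m} → 2 ≤ n G → HellyBound G m → 2 ≤ m
  2≤helly-bound 2≤n bound = ≤-trans (2≤∣pair∣ x≢y) (helly-independent⇒size≤ bound (pair-helly-independent {x} {y}))
    where
    x y : V G
    x = fromℕ< (≤-trans (s≤s z≤n) 2≤n)
    y = fromℕ< 2≤n
    x≢y : x ≢ y
    x≢y x≡y with ≡.trans (≡.sym (toℕ-fromℕ< (≤-trans (s≤s z≤n) 2≤n))) (≡.trans (cong toℕ x≡y) (toℕ-fromℕ< 2≤n))
    ... | ()

  edge? : ∀ S → Dec (∃₂ λ u w → u ∈ S × w ∈ S × E G u w)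
  edge? S = any? λ u → any? λ w → u ∈? S ×-dec w ∈? S ×-dec T? (adj G u w)

  module _ (two-connected : TwoConnected G) (chordal : Chordal G) where

    edge-hull : ∀ {S x y} → x ∈ S → y ∈ S → E G x y → ∀ v → InHull G S v
    edge-hull x∈S y∈S xy v C convex S⊆C = Δ-convex-full G two-connected chordal convex (S⊆C x∈S) (S⊆C y∈S) xy v

    helly-bound : ∀ {a} → IsIndependenceNumber G a → HellyBound G (2 ⊔ a)
    helly-bound {a} (_ , maximal) S 2⊔a<∣S∣ with edge? S
    ... | no no-edge = ⊥-elim (<⇒≱ (m⊔n<o⇒n<o 2 a 2⊔a<∣S∣)
                         (maximal S λ u w u∈ w∈ uw → no-edge (u , w , u∈ , w∈ , uw)))
    ... | yes (x , y , x∈S , y∈S , xy) with third-element (m⊔n<o⇒m<o 2 a 2⊔a<∣S∣) x y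
    ...   | z , z∈S , z≢x , z≢y = z , z∈hull
      where
      z∈hull : ∀ b → b ∈ S → InHull G (S - b) z
      z∈hull b b∈S with b ≟ᶠ z
      ... | yes refl = edge-hull (x∈p∧x≢y⇒x∈p-y x∈S (z≢x ∘ ≡.sym)) (x∈p∧x≢y⇒x∈p-y y∈S (z≢y ∘ ≡.sym)) xy z
      ... | no  b≢z  = hull-⊇ (x∈p∧x≢y⇒x∈p-y z∈S (b≢z ∘ ≡.sym))

corollary1 : (G : Graph) → TwoConnected G → Chordal G →
    (a : ℕ) → IsIndependenceNumber G a → IsHellyNumber G (2 ⊔ a)
corollary1 G two-connected chordal a α@((I , I-independent , ∣I∣≡a) , _) =
  helly-bound G two-connected chordal α ,
  λ m bound → ⊔-lub (2≤helly-bound G (≤-trans (n≤1+n 2) (proj₁ two-connected)) bound)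
                    (subst (_≤ m) ∣I∣≡a (independent⇒size≤ G bound I-independent))
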